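{- Let $p$ be a prime, let $S\subseteq\{0,\ldots,p-1\}$ with $|S|=n\ge 1$, let $a$ be uniformly random in $\{1,\ldots,p-1\}$, and let $h(x)=ax\bmod p$. For a fixed $a$, let $x_1,\ldots,x_n$ be the elements of $S$ sorted by $h$-value (ties broken arbitrarily), let $I_0=[0,h(x_1))$, $I_i=[h(x_i),h(x_{i+1}))$ for $1\le i\le n-1$, $I_n=[h(x_n),p)$, where $|[\alpha,\beta)|=\beta-\alpha$, and define $\ell_+(x_1)=|I_1|$ and $\ell_+(x_i)=\min\{|I_{i-1}|,|I_i|\}$ for $2\le i\le n$. Then for every $x\in S$ and every positive integer $\delta$, \[\Pr_a[\ell_+(x)\ge\delta]\ \ge\ 1-2n(\delta-1)/(p-1).\] -}

module Defs where

open import Data.Nat using (ℕ; zero; suc; _+_; _*_; _∸_; _≤ᵇ_; _≡ᵇ_; _⊓_; _≤?_)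
open import Data.Nat.DivMod using (_%_)
open import Data.Bool using (Bool; if_then_else_)
open import Data.List using (List; []; _∷_; foldr; zipWith; zip; filter; map; length; upTo)
open import Data.Product using (_×_; _,_)

-- h(x) = a x mod p   (p = 0 never occurs; p is prime in the statement)
h : (p a x : ℕ) → ℕ
h zero    a x = 0
h (suc q) a x = (a * x) % suc q

insertBy : (ℕ → ℕ) → ℕ → List ℕ → List ℕ
insertBy key x []       = x ∷ []
insertBy key x (y ∷ ys) = if key x ≤ᵇ key y then x ∷ y ∷ ys else y ∷ insertBy key x ys

sortBy : (ℕ → ℕ) → List ℕ → List ℕ
sortBy key = foldr (insertBy key) []

-- Given the sorted h-values v₁ ≤ … ≤ vₙ, the list |I₁|, …, |Iₙ|
-- where Iᵢ = [vᵢ, vᵢ₊₁) for i < n and Iₙ = [vₙ, p).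
upperLengths : ℕ → List ℕ → List ℕ
upperLengths p []           = []
upperLengths p (v ∷ [])     = (p ∸ v) ∷ []
upperLengths p (v ∷ w ∷ ws) = (w ∸ v) ∷ upperLengths p (w ∷ ws)

-- ℓ₊(x₁) = |I₁|,  ℓ₊(xᵢ) = min(|Iᵢ₋₁|, |Iᵢ|) for 2 ≤ i ≤ n
ellList : ℕ → List ℕ → List ℕ
ellList p vs with upperLengths p vs
... | []      = []
... | g ∷ gs  = g ∷ zipWith _⊓_ (g ∷ gs) gs

assoc : ℕ → List (ℕ × ℕ) → ℕ
assoc x []             = 0
assoc x ((y , l) ∷ r)  = if x ≡ᵇ y then l else assoc x r

sortedByH : (p a : ℕ) → List ℕ → List ℕ
sortedByH p a S = sortBy (h p a) S

ellPlus : (p a : ℕ) → List ℕ → ℕ → ℕ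
ellPlus p a S x =
  let xs = sortedByH p a S in
  assoc x (zip xs (ellList p (map (h p a) xs)))

multipliers : ℕ → List ℕ
multipliers p = map suc (upTo (p ∸ 1))

goodCount : (p : ℕ) → List ℕ → ℕ → ℕ → ℕ
goodCount p S x δ = length (filter (λ a → δ ≤? ellPlus p a S x) (multipliers p))

module Submission where

-- Fix x ∈ S and write δ = δ' + 1.  Call a multiplier a bad
-- if ℓ₊(x) ≤ δ'.  For a bad a the value ℓ₊(x) is the length of an interval
-- adjacent to x in the sorted order, so one of the following "shift events"
-- happens, for some y ∈ S and some gap L with 1 ≤ L ≤ δ':
--   h(y) = h(x) + L   (y lies L above x),
--   h(x) = h(y) + L   (y lies L below x, y ≠ x),
--   h(x) = h(0) + (p − L)   (x lies L below p).
-- These are 2·|S|·δ' tagged events (the impossible "x below x" slot is reused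
-- for the last one).  Each event h_a(u) = h_a(v) + d with d > 0 and u, v < p
-- happens for at most one a < p: two such multipliers a, a' give
-- (a − a')(u − v) ≡ 0 (mod p), and p is prime.  A union bound over the tags
-- then bounds the number of bad multipliers by 2·|S|·δ'.

open import Defs
open import Data.Bool using (true; false; if_then_else_)
open import Data.Empty using (⊥-elim)
open import Data.List using (List; []; _∷_; _++_; map; zip; zipWith; filter; length; upTo; cartesianProductWith)
open import Data.List.Membership.Propositional using (_∈_; lose)
open import Data.List.Membership.Propositional.Properties
  using (∈-map⁺; ∈-map⁻; ∈-upTo⁺; ∈-upTo⁻; ∈-++⁺ˡ; ∈-++⁺ʳ; ∈-++⁻; ∈-cartesianProductWith⁺; ∈-cartesianProductWith⁻)
open import Data.List.Properties using (filter-none; length-map; length-upTo; length-++)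
open import Data.List.Relation.Binary.Permutation.Propositional using (_↭_; ↭-refl; ↭-prep; ↭-swap; ↭-sym; ↭-trans; ↭⇒↭ₛ)
open import Data.List.Relation.Binary.Permutation.Propositional.Properties using (∈-resp-↭)
import Data.List.Relation.Binary.Permutation.Setoid.Properties as Permutationₛ
open import Data.List.Relation.Binary.Subset.Propositional using (_⊆_)
open import Data.List.Relation.Unary.All as All using (All; _∷_)
open import Data.List.Relation.Unary.Any using (Any; here; there)
open import Data.List.Relation.Unary.AllPairs using (_∷_)
open import Data.List.Relation.Unary.Linked using (Linked; []; [-]; _∷_)
open import Data.List.Relation.Unary.Unique.Propositional using (Unique)
import Data.List.Relation.Unary.Unique.Propositional.Properties as Unique
open import Data.Nat using (ℕ; zero; suc; _+_; _*_; _∸_; _≤_; _<_; _≤ᵇ_; _≡ᵇ_; _⊓_; z≤n; s≤s; NonZero; >-nonZero; ≢-nonZero⁻¹)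
open import Data.Nat.Divisibility using (_∣_; divides; ∣m+n∣m⇒∣n; >⇒∤)
open import Data.Nat.DivMod using (_%_; _/_; m≡m%n+[m/n]*n; %-distribˡ-+; m%n<n)
open import Data.Nat.ListAction using (sum)
open import Data.Nat.Primality using (Prime; euclidsLemma; prime⇒nonZero)
open import Data.Nat.Properties
open import Algebra.Properties.CommutativeSemigroup +-commutativeSemigroup using (x∙yz≈y∙xz; xy∙z≈zy∙x)
open import Data.Nat.Tactic.RingSolver using (solve-∀)
open import Data.Product using (_×_; _,_; proj₁; proj₂)
open import Data.Sum using (_⊎_; inj₁; inj₂)
open import Level using (0ℓ)
open import Function using (_∘_)
open import Relation.Binary using (tri<; tri≈; tri>)
open import Relation.Binary.PropositionalEquality
open import Relation.Nullary using (¬_; yes; no; contradiction)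
open import Relation.Nullary.Reflects using (ofʸ; ofⁿ)
open import Relation.Unary using (Pred; Decidable)

≡ᵇ-refl : ∀ n → (n ≡ᵇ n) ≡ true
≡ᵇ-refl n with n ≡ᵇ n | ≡⇒≡ᵇ n n refl
... | true | _ = refl

≢⇒≡ᵇ-false : ∀ {m n} → m ≢ n → (m ≡ᵇ n) ≡ false
≢⇒≡ᵇ-false {m} {n} m≢n with m ≡ᵇ n | ≡ᵇ⇒≡ m n
... | false | _    = refl
... | true  | toEq = contradiction (toEq _) m≢n

gap-positive : ∀ {m n L} → m ≤ n → m ≢ n → L ≡ n ∸ m → 0 < L
gap-positive m≤n m≢n refl = m<n⇒0<n∸m (≤∧≢⇒< m≤n m≢n)

length-cartesianProductWith : ∀ {A B C : Set} (f : A → B → C) xs ys →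
                              length (cartesianProductWith f xs ys) ≡ length xs * length ys
length-cartesianProductWith f []       ys = refl
length-cartesianProductWith f (x ∷ xs) ys = begin
  length (map (f x) ys ++ cartesianProductWith f xs ys)        ≡⟨ length-++ (map (f x) ys) ⟩
  length (map (f x) ys) + length (cartesianProductWith f xs ys) ≡⟨ cong₂ _+_ (length-map (f x) ys) (length-cartesianProductWith f xs ys) ⟩
  length ys + length xs * length ys                             ∎
  where open ≡-Reasoning

positives : ℕ → List ℕ
positives n = map suc (upTo n)

∈-positives⁺ : ∀ {n L} → 0 < L → L ≤ n → L ∈ positives n
∈-positives⁺ {L = suc i} _ i<n = ∈-map⁺ suc (∈-upTo⁺ i<n)

∈-positives⁻ : ∀ {n L} → L ∈ positives n → 0 < L × L ≤ n
∈-positives⁻ L∈ with i , i∈ , refl ← ∈-map⁻ suc L∈ = s≤s z≤n , ∈-upTo⁻ i∈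

positives-unique : ∀ n → Unique (positives n)
positives-unique n = Unique.map⁺ suc-injective (Unique.upTo⁺ n)

length-positives : ∀ n → length (positives n) ≡ n
length-positives n = trans (length-map suc (upTo n)) (length-upTo n)

module SortedByKey (key : ℕ → ℕ) where

  Ordered : List ℕ → Set
  Ordered = Linked (λ a b → key a ≤ key b)

  insertBy-↭ : ∀ x ys → insertBy key x ys ↭ x ∷ ys
  insertBy-↭ x [] = ↭-refl
  insertBy-↭ x (y ∷ ys) with key x ≤ᵇ key y
  ... | true  = ↭-refl
  ... | false = ↭-trans (↭-prep y (insertBy-↭ x ys)) (↭-swap y x ↭-refl)

  sortBy-↭ : ∀ xs → sortBy key xs ↭ xs
  sortBy-↭ []       = ↭-refl
  sortBy-↭ (x ∷ xs) = ↭-trans (insertBy-↭ x (sortBy key xs)) (↭-prep x (sortBy-↭ xs))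

  sortBy-⊆ : ∀ xs → sortBy key xs ⊆ xs
  sortBy-⊆ xs = ∈-resp-↭ (sortBy-↭ xs)

  sortBy-⊇ : ∀ xs → xs ⊆ sortBy key xs
  sortBy-⊇ xs = ∈-resp-↭ (↭-sym (sortBy-↭ xs))

  sortBy-unique : ∀ xs → Unique xs → Unique (sortBy key xs)
  sortBy-unique xs = Permutationₛ.Unique-resp-↭ (setoid ℕ) (↭⇒↭ₛ (↭-sym (sortBy-↭ xs)))

  insertBy-ordered-behind : ∀ {z} x ys → key z ≤ key x → Ordered (z ∷ ys) → Ordered (z ∷ insertBy key x ys)
  insertBy-ordered-behind x [] z≤x _ = z≤x ∷ [-]
  insertBy-ordered-behind x (y ∷ ys) z≤x (z≤y ∷ ord) with key x ≤ᵇ key y | ≤ᵇ-reflects-≤ (key x) (key y)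
  ... | true  | ofʸ x≤y = z≤x ∷ x≤y ∷ ord
  ... | false | ofⁿ x≰y = z≤y ∷ insertBy-ordered-behind x ys (<⇒≤ (≰⇒> x≰y)) ord

  insertBy-ordered : ∀ x ys → Ordered ys → Ordered (insertBy key x ys)
  insertBy-ordered x [] _ = [-]
  insertBy-ordered x (y ∷ ys) ord with key x ≤ᵇ key y | ≤ᵇ-reflects-≤ (key x) (key y)
  ... | true  | ofʸ x≤y = x≤y ∷ ord
  ... | false | ofⁿ x≰y = insertBy-ordered-behind x ys (<⇒≤ (≰⇒> x≰y)) ord

  sortBy-ordered : ∀ xs → Ordered (sortBy key xs)
  sortBy-ordered []       = []
  sortBy-ordered (x ∷ xs) = insertBy-ordered x (sortBy key xs) (sortBy-ordered xs)

module IntervalLengths (p : ℕ) where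

  upperGap : ℕ → List ℕ → ℕ
  upperGap v []      = p ∸ v
  upperGap v (w ∷ _) = w ∸ v

  upperLengths-∷ : ∀ v vs → upperLengths p (v ∷ vs) ≡ upperGap v vs ∷ upperLengths p vs
  upperLengths-∷ v []      = refl
  upperLengths-∷ v (w ∷ ws) = refl

  minGaps : ℕ → List ℕ → List ℕ
  minGaps v vs = zipWith _⊓_ (upperLengths p (v ∷ vs)) (upperLengths p vs)

  ellList-∷ : ∀ v vs → ellList p (v ∷ vs) ≡ upperGap v vs ∷ minGaps v vs
  ellList-∷ v vs rewrite upperLengths-∷ v vs = refl

  minGaps-∷ : ∀ v w ws → minGaps v (w ∷ ws) ≡ ((w ∸ v) ⊓ upperGap w ws) ∷ minGaps w ws
  minGaps-∷ v w ws rewrite upperLengths-∷ w ws = refl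

-- Each value of ℓ₊ is the length of an interval adjacent to its point: the
-- distance from x to p, or to another point whose key lies above or below x.
module Neighbours (p : ℕ) (key : ℕ → ℕ) where
  open SortedByKey key
  open IntervalLengths p

  data GapOf (x : ℕ) (xs : List ℕ) (L : ℕ) : Set where
    toEnd   : L ≡ p ∸ key x → GapOf x xs L
    toAbove : ∀ {y} → y ∈ xs → y ≢ x → key x ≤ key y → L ≡ key y ∸ key x → GapOf x xs L
    toBelow : ∀ {w} → w ∈ xs → w ≢ x → key w ≤ key x → L ≡ key x ∸ key w → GapOf x xs L

  GapOf-⊆ : ∀ {x xs ys L} → xs ⊆ ys → GapOf x xs L → GapOf x ys L
  GapOf-⊆ _     (toEnd e)              = toEnd e
  GapOf-⊆ xs⊆ys (toAbove y∈ y≢x le e) = toAbove (xs⊆ys y∈) y≢x le e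
  GapOf-⊆ xs⊆ys (toBelow w∈ w≢x le e) = toBelow (xs⊆ys w∈) w≢x le e

  upperGap-isGap : ∀ x ys → Ordered (x ∷ ys) → Unique (x ∷ ys) →
                   GapOf x (x ∷ ys) (upperGap (key x) (map key ys))
  upperGap-isGap x []       _           _                = toEnd refl
  upperGap-isGap x (y ∷ ys) (x≤y ∷ _) ((x≢y ∷ _) ∷ _) = toAbove (there (here refl)) (x≢y ∘ sym) x≤y refl

  minGaps-isGap : ∀ {x} w xs → Ordered (w ∷ xs) → Unique (w ∷ xs) → x ∈ xs →
                  GapOf x (w ∷ xs) (assoc x (zip xs (minGaps (key w) (map key xs))))
  minGaps-isGap w (y ∷ ys) (w≤y ∷ ord) ((w≢y ∷ _) ∷ uniq) (here refl)
    rewrite minGaps-∷ (key w) (key y) (map key ys) | ≡ᵇ-refl y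
    with ⊓-sel (key y ∸ key w) (upperGap (key y) (map key ys))
  ... | inj₁ lower = toBelow (here refl) w≢y w≤y lower
  ... | inj₂ upper = subst (GapOf y (w ∷ y ∷ ys)) (sym upper) (GapOf-⊆ there (upperGap-isGap y ys ord uniq))
  minGaps-isGap w (y ∷ ys) (_ ∷ ord) (_ ∷ uniq@(y∉ys ∷ _)) (there x∈ys)
    rewrite minGaps-∷ (key w) (key y) (map key ys) | ≢⇒≡ᵇ-false (All.lookup y∉ys x∈ys ∘ sym)
    = GapOf-⊆ there (minGaps-isGap y ys ord uniq x∈ys)

  ellList-isGap : ∀ {x} xs → Ordered xs → Unique xs → x ∈ xs →
                  GapOf x xs (assoc x (zip xs (ellList p (map key xs))))
  ellList-isGap (y ∷ ys) ord uniq (here refl)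
    rewrite ellList-∷ (key y) (map key ys) | ≡ᵇ-refl y = upperGap-isGap y ys ord uniq
  ellList-isGap (y ∷ ys) ord uniq@(y∉ys ∷ _) (there x∈ys)
    rewrite ellList-∷ (key y) (map key ys) | ≢⇒≡ᵇ-false (All.lookup y∉ys x∈ys ∘ sym)
    = minGaps-isGap y ys ord uniq x∈ys

same-remainder⇒∣ : ∀ R t p .{{_ : NonZero p}} → (R + t) % p ≡ R % p → p ∣ t
same-remainder⇒∣ R t p eq = ∣m+n∣m⇒∣n (divides ((R + t) / p) quotients) (divides (R / p) refl)
  where
  open ≡-Reasoning
  quotients : (R / p) * p + t ≡ ((R + t) / p) * p
  quotients = +-cancelˡ-≡ (R % p) _ _ (begin
    R % p + ((R / p) * p + t)     ≡⟨ sym (+-assoc (R % p) _ t) ⟩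
    R % p + (R / p) * p + t       ≡⟨ cong (_+ t) (sym (m≡m%n+[m/n]*n R p)) ⟩
    R + t                         ≡⟨ m≡m%n+[m/n]*n (R + t) p ⟩
    (R + t) % p + ((R + t) / p) * p ≡⟨ cong (_+ ((R + t) / p) * p) eq ⟩
    R % p + ((R + t) / p) * p     ∎)

∤-between : ∀ {p n} → 0 < n → n < p → ¬ (p ∣ n)
∤-between n>0 n<p = >⇒∤ {{>-nonZero n>0}} n<p

cross-term : ∀ {a a' u v} → a' ≤ a → v ≤ u → a * u + a' * v ≡ (a' * u + a * v) + (a ∸ a') * (u ∸ v)
cross-term {a' = a'} {v = v} a'≤a v≤u
  with k , refl ← m≤n⇒∃[o]m+o≡n a'≤a | m , refl ← m≤n⇒∃[o]m+o≡n v≤u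
  rewrite m+n∸m≡n a' k | m+n∸m≡n v m = expand a' k v m
  where
  expand : ∀ a' k v m → (a' + k) * (v + m) + a' * v ≡ (a' * (v + m) + (a' + k) * v) + k * m
  expand = solve-∀

CrossSums : (p : ℕ) .{{_ : NonZero p}} → ℕ → ℕ → ℕ → ℕ → Set
CrossSums p a a' u v = (a * u + a' * v) % p ≡ (a' * u + a * v) % p

cross-sums-swapᵤ : ∀ {p a a' u v} .{{_ : NonZero p}} → CrossSums p a a' u v → CrossSums p a a' v u
cross-sums-swapᵤ {p} {a} {a'} {u} {v} eq = begin
  (a * v + a' * u) % p ≡⟨ cong (_% p) (+-comm (a * v) (a' * u)) ⟩
  (a' * u + a * v) % p ≡⟨ sym eq ⟩
  (a * u + a' * v) % p ≡⟨ cong (_% p) (+-comm (a * u) (a' * v)) ⟩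
  (a' * v + a * u) % p ∎
  where open ≡-Reasoning

-- Modulo a prime p, the cross sums of a' < a < p and v < u < p differ,
-- since their difference (a − a')(u − v) is a product of non-multiples of p.
cross-sums-differ : ∀ {p a a' u v} .{{_ : NonZero p}} → Prime p → a' < a → v < u → a < p → u < p → ¬ CrossSums p a a' u v
cross-sums-differ {p} {a} {a'} {u} {v} pr a'<a v<u a<p u<p eq
  with euclidsLemma (a ∸ a') (u ∸ v) pr (same-remainder⇒∣ (a' * u + a * v) _ p shifted)
  where
  shifted : (a' * u + a * v + (a ∸ a') * (u ∸ v)) % p ≡ (a' * u + a * v) % p
  shifted = trans (cong (_% p) (sym (cross-term (<⇒≤ a'<a) (<⇒≤ v<u)))) eq
... | inj₁ p∣a-a' = ∤-between (m<n⇒0<n∸m a'<a) (≤-<-trans (m∸n≤m a a') a<p) p∣a-a'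
... | inj₂ p∣u-v  = ∤-between (m<n⇒0<n∸m v<u) (≤-<-trans (m∸n≤m u v) u<p) p∣u-v

cross-cancel : ∀ {p a a' u v} .{{_ : NonZero p}} → Prime p → a < p → a' < p → u < p → v < p →
               CrossSums p a a' u v → a ≡ a' ⊎ u ≡ v
cross-cancel {a = a} {a'} {u} {v} pr a<p a'<p u<p v<p eq with <-cmp a a' | <-cmp u v
... | tri≈ _ a≡a' _ | _             = inj₁ a≡a'
... | _             | tri≈ _ u≡v _ = inj₂ u≡v
... | tri> _ _ a'<a | tri> _ _ v<u = ⊥-elim (cross-sums-differ pr a'<a v<u a<p u<p eq)
... | tri> _ _ a'<a | tri< u<v _ _ = ⊥-elim (cross-sums-differ pr a'<a u<v a<p v<p (cross-sums-swapᵤ {a = a} {a'} {u} {v} eq))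
... | tri< a<a' _ _ | tri> _ _ v<u = ⊥-elim (cross-sums-differ pr a<a' v<u a'<p u<p (sym eq))
... | tri< a<a' _ _ | tri< u<v _ _ = ⊥-elim (cross-sums-differ pr a<a' u<v a'<p v<p (sym (cross-sums-swapᵤ {a = a} {a'} {u} {v} eq)))

module MultiplicativeHash (q : ℕ) (pr : Prime (suc q)) where

  p : ℕ
  p = suc q

  h<p : ∀ a y → h p a y < p
  h<p a y = m%n<n (a * y) p

  h-zero : ∀ a → h p a 0 ≡ 0
  h-zero a = cong (_% p) (*-zeroʳ a)

  Shift : ℕ → ℕ → ℕ → ℕ → Set
  Shift u v d a = h p a u ≡ h p a v + d

  shift-cross-sums : ∀ {u v d a a'} → Shift u v d a → Shift u v d a' → CrossSums p a a' u v
  shift-cross-sums {u} {v} {d} {a} {a'} shiftₐ shiftₐ' = begin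
    (a * u + a' * v) % p         ≡⟨ %-distribˡ-+ (a * u) (a' * v) p ⟩
    (h p a u + h p a' v) % p     ≡⟨ cong (λ s → (s + h p a' v) % p) shiftₐ ⟩
    (h p a v + d + h p a' v) % p ≡⟨ cong (_% p) (xy∙z≈zy∙x (h p a v) d (h p a' v)) ⟩
    (h p a' v + d + h p a v) % p ≡⟨ cong (λ s → (s + h p a v) % p) (sym shiftₐ') ⟩
    (h p a' u + h p a v) % p     ≡⟨ sym (%-distribˡ-+ (a' * u) (a * v) p) ⟩
    (a' * u + a * v) % p         ∎
    where open ≡-Reasoning

  shift-unique : ∀ {u v d a a'} → 0 < d → u < p → v < p → a < p → a' < p →
                 Shift u v d a → Shift u v d a' → a ≡ a'
  shift-unique {u} {v} {d} {a} {a'} d>0 u<p v<p a<p a'<p shiftₐ shiftₐ'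
    with cross-cancel pr a<p a'<p u<p v<p (shift-cross-sums {u} {v} {d} {a} {a'} shiftₐ shiftₐ')
  ... | inj₁ a≡a' = a≡a'
  ... | inj₂ refl = contradiction shiftₐ (<⇒≢ (m<m+n (h p a u) d>0))

  h-injective : ∀ {a y z} → 0 < a → a < p → y < p → z < p → h p a y ≡ h p a z → y ≡ z
  h-injective {a} {y} {z} a>0 a<p y<p z<p eq
    with cross-cancel pr a<p (s≤s z≤n) y<p z<p (shift-cross-sums {y} {z} {0} {a} {0} (trans eq (sym (+-identityʳ _))) refl)
  ... | inj₁ refl = contradiction a>0 (<-irrefl refl)
  ... | inj₂ y≡z  = y≡z

count≤1 : ∀ {A : Set} {P : Pred A 0ℓ} (P? : Decidable P) {L} → Unique L →
          (∀ {a b} → a ∈ L → b ∈ L → P a → P b → a ≡ b) → length (filter P? L) ≤ 1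
count≤1 P? {[]} _ _ = z≤n
count≤1 {P = P} P? {a ∷ L} (a∉L ∷ uniq) atMostOne with P? a
... | yes pa = s≤s (≤-reflexive (cong length (filter-none P? (All.tabulate others-fail))))
  where
  others-fail : ∀ {b} → b ∈ L → ¬ P b
  others-fail b∈L pb = All.lookup a∉L b∈L (atMostOne (here refl) (there b∈L) pa pb)
... | no _ = count≤1 P? uniq (λ a∈L b∈L → atMostOne (there a∈L) (there b∈L))

module UnionBound {A T : Set} (Q : T → Pred A 0ℓ) (Q? : ∀ t → Decidable (Q t)) where

  hits : A → List T → ℕ
  hits a D = length (filter (λ t → Q? t a) D)

  incidences : List T → List A → ℕ
  incidences D L = sum (map (λ t → length (filter (Q? t) L)) D)

  incidences-∷ : ∀ D a L → incidences D (a ∷ L) ≡ hits a D + incidences D L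
  incidences-∷ []      a L = refl
  incidences-∷ (t ∷ D) a L with Q? t a
  ... | yes _ = cong suc (trans (cong (_ +_) (incidences-∷ D a L)) (x∙yz≈y∙xz (length (filter (Q? t) L)) (hits a D) (incidences D L)))
  ... | no _  = trans (cong (_ +_) (incidences-∷ D a L)) (x∙yz≈y∙xz (length (filter (Q? t) L)) (hits a D) (incidences D L))

  hits-pos : ∀ {a} D → Any (λ t → Q t a) D → 0 < hits a D
  hits-pos {a} (t ∷ D) occurs with Q? t a | occurs
  ... | yes _ | _          = s≤s z≤n
  ... | no ¬q | here q     = contradiction q ¬q
  ... | no _  | there occ = hits-pos D occ

  union-bound : ∀ {P : Pred A 0ℓ} (P? : Decidable P) D L → (∀ {a} → a ∈ L → P a ⊎ Any (λ t → Q t a) D) →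
                length L ≤ length (filter P? L) + incidences D L
  union-bound P? D []      covered = z≤n
  union-bound P? D (a ∷ L) covered with P? a | covered (here refl)
  ... | yes _  | _         = s≤s (≤-trans (union-bound P? D L (covered ∘ there)) (+-monoʳ-≤ _ rest≤))
    where
    rest≤ : incidences D L ≤ incidences D (a ∷ L)
    rest≤ = ≤-trans (m≤n+m _ (hits a D)) (≤-reflexive (sym (incidences-∷ D a L)))
  ... | no ¬pa | inj₁ pa  = contradiction pa ¬pa
  ... | no _   | inj₂ occ = begin
    suc (length L)                                           ≤⟨ s≤s (union-bound P? D L (covered ∘ there)) ⟩
    suc (length (filter P? L) + incidences D L)              ≡⟨ sym (+-suc _ _) ⟩
    length (filter P? L) + suc (incidences D L)              ≤⟨ +-monoʳ-≤ _ (+-monoˡ-≤ _ (hits-pos D occ)) ⟩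
    length (filter P? L) + (hits a D + incidences D L)       ≡⟨ cong (_ +_) (sym (incidences-∷ D a L)) ⟩
    length (filter P? L) + incidences D (a ∷ L)              ∎
    where open ≤-Reasoning

  incidences-≤ : ∀ D L → (∀ {t} → t ∈ D → length (filter (Q? t) L) ≤ 1) → incidences D L ≤ length D
  incidences-≤ []      L once = z≤n
  incidences-≤ (t ∷ D) L once = +-mono-≤ (once (here refl)) (incidences-≤ D L (once ∘ there))

module ShortGaps (q : ℕ) (pr : Prime (suc q)) (S : List ℕ) (uniqS : Unique S) (S<p : All (_< suc q) S)
                 (x : ℕ) (x∈S : x ∈ S) (δ' : ℕ) (δ'<p : δ' < suc q) where
  open MultiplicativeHash q pr

  x<p : x < p
  x<p = All.lookup S<p x∈S

  Tag : Set
  Tag = ℕ × ℕ × ℕ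

  Occurs : Tag → Pred ℕ 0ℓ
  Occurs (u , v , d) = Shift u v d

  occurs? : ∀ t → Decidable (Occurs t)
  occurs? (u , v , d) a = h p a u ≟ h p a v + d

  aboveTag : ℕ → ℕ → Tag
  aboveTag y L = y , x , L

  -- w lies L below x; for w = x this impossible event is replaced by
  -- "x lies L below p", i.e. x lies p − L above 0
  belowTag : ℕ → ℕ → Tag
  belowTag w L = if w ≡ᵇ x then (x , 0 , p ∸ L) else (x , w , L)

  belowTag-self : ∀ L → belowTag x L ≡ (x , 0 , p ∸ L)
  belowTag-self L rewrite ≡ᵇ-refl x = refl

  belowTag-other : ∀ {w} L → w ≢ x → belowTag w L ≡ (x , w , L)
  belowTag-other L w≢x rewrite ≢⇒≡ᵇ-false w≢x = refl

  tags : List Tag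
  tags = cartesianProductWith aboveTag S (positives δ') ++ cartesianProductWith belowTag S (positives δ')

  aboveTag∈ : ∀ {y L} → y ∈ S → 0 < L → L ≤ δ' → aboveTag y L ∈ tags
  aboveTag∈ y∈S L>0 L≤δ' = ∈-++⁺ˡ (∈-cartesianProductWith⁺ aboveTag y∈S (∈-positives⁺ L>0 L≤δ'))

  belowTag∈ : ∀ {w L} → w ∈ S → 0 < L → L ≤ δ' → belowTag w L ∈ tags
  belowTag∈ w∈S L>0 L≤δ' = ∈-++⁺ʳ _ (∈-cartesianProductWith⁺ belowTag w∈S (∈-positives⁺ L>0 L≤δ'))

  length-tags : length tags ≡ 2 * length S * δ'
  length-tags = begin
    length tags
      ≡⟨ length-++ (cartesianProductWith aboveTag S (positives δ')) ⟩
    length (cartesianProductWith aboveTag S (positives δ')) + length (cartesianProductWith belowTag S (positives δ'))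
      ≡⟨ cong₂ _+_ (length-cartesianProductWith aboveTag S (positives δ')) (length-cartesianProductWith belowTag S (positives δ')) ⟩
    length S * length (positives δ') + length S * length (positives δ')
      ≡⟨ cong (λ n → length S * n + length S * n) (length-positives δ') ⟩
    length S * δ' + length S * δ'
      ≡⟨ double (length S) δ' ⟩
    2 * length S * δ'                                   ∎
    where
    open ≡-Reasoning
    double : ∀ n d → n * d + n * d ≡ 2 * n * d
    double = solve-∀

  Admissible : Tag → Set
  Admissible (u , v , d) = u < p × v < p × 0 < d

  belowTag-admissible : ∀ {w L} → w < p → 0 < L × L ≤ δ' → Admissible (belowTag w L)
  belowTag-admissible {w} {L} w<p (L>0 , L≤δ') with w ≡ᵇ x
  ... | true  = x<p , s≤s z≤n , m<n⇒0<n∸m (≤-<-trans L≤δ' δ'<p)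
  ... | false = x<p , w<p , L>0

  tags-admissible : ∀ {t} → t ∈ tags → Admissible t
  tags-admissible t∈ with ∈-++⁻ (cartesianProductWith aboveTag S (positives δ')) t∈
  ... | inj₁ t∈above with y , L , y∈S , L∈ , refl ← ∈-cartesianProductWith⁻ aboveTag S (positives δ') t∈above
    = All.lookup S<p y∈S , x<p , proj₁ (∈-positives⁻ L∈)
  ... | inj₂ t∈below with w , L , w∈S , L∈ , refl ← ∈-cartesianProductWith⁻ belowTag S (positives δ') t∈below
    = belowTag-admissible (All.lookup S<p w∈S) (∈-positives⁻ L∈)

  multiplier-range : ∀ {a} → a ∈ multipliers p → 0 < a × a < p
  multiplier-range a∈ with a>0 , a≤q ← ∈-positives⁻ a∈ = a>0 , s≤s a≤q

  occurs-once : ∀ {t} → t ∈ tags → length (filter (occurs? t) (multipliers p)) ≤ 1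
  occurs-once {u , v , d} t∈ with u<p , v<p , d>0 ← tags-admissible t∈ =
    count≤1 (occurs? (u , v , d)) (positives-unique q)
      (λ a∈ a'∈ → shift-unique d>0 u<p v<p (proj₂ (multiplier-range a∈)) (proj₂ (multiplier-range a'∈)))

  module AtMultiplier {a} (a>0 : 0 < a) (a<p : a < p) where
    open SortedByKey (h p a)
    open Neighbours p (h p a)

    h-separates : ∀ {y} → y ∈ S → y ≢ x → h p a y ≢ h p a x
    h-separates y∈S y≢x = y≢x ∘ h-injective a>0 a<p (All.lookup S<p y∈S) x<p

    gap⇒tag : ∀ {L} → GapOf x S L → L ≤ δ' → Any (λ t → Occurs t a) tags
    gap⇒tag {L} (toEnd L≡) L≤δ' =
      lose (subst (_∈ tags) (belowTag-self L) (belowTag∈ x∈S L>0 L≤δ')) atEnd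
      where
      L>0 : 0 < L
      L>0 = gap-positive (<⇒≤ (h<p a x)) (<⇒≢ (h<p a x)) L≡
      atEnd : Shift x 0 (p ∸ L) a
      atEnd = begin
        h p a x                 ≡⟨ sym (m∸[m∸n]≡n (<⇒≤ (h<p a x))) ⟩
        p ∸ (p ∸ h p a x)       ≡⟨ cong (p ∸_) (sym L≡) ⟩
        p ∸ L                   ≡⟨ cong (_+ (p ∸ L)) (sym (h-zero a)) ⟩
        h p a 0 + (p ∸ L)       ∎
        where open ≡-Reasoning
    gap⇒tag {L} (toAbove y∈S y≢x hx≤hy L≡) L≤δ' =
      lose (aboveTag∈ y∈S (gap-positive hx≤hy (h-separates y∈S y≢x ∘ sym) L≡) L≤δ')
           (sym (trans (cong (h p a x +_) L≡) (m+[n∸m]≡n hx≤hy)))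
    gap⇒tag {L} (toBelow {w} w∈S w≢x hw≤hx L≡) L≤δ' =
      lose (subst (_∈ tags) (belowTag-other L w≢x) (belowTag∈ w∈S (gap-positive hw≤hx (h-separates w∈S w≢x) L≡) L≤δ'))
           (sym (trans (cong (h p a w +_) L≡) (m+[n∸m]≡n hw≤hx)))

    good-or-tagged : suc δ' ≤ ellPlus p a S x ⊎ Any (λ t → Occurs t a) tags
    good-or-tagged with suc δ' ≤? ellPlus p a S x
    ... | yes δ≤ℓ = inj₁ δ≤ℓ
    ... | no δ≰ℓ  = inj₂ (gap⇒tag (GapOf-⊆ (sortBy-⊆ S) ℓ-isGap) (≤-pred (≰⇒> δ≰ℓ)))
      where
      ℓ-isGap : GapOf x (sortBy (h p a) S) (ellPlus p a S x)
      ℓ-isGap = ellList-isGap (sortBy (h p a) S) (sortBy-ordered S) (sortBy-unique S uniqS) (sortBy-⊇ S x∈S)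

  open UnionBound Occurs occurs?

  bound : p ∸ 1 ≤ goodCount p S x (suc δ') + 2 * length S * δ'
  bound = begin
    q                                         ≡⟨ sym (length-positives q) ⟩
    length (multipliers p)                    ≤⟨ union-bound (λ a → suc δ' ≤? ellPlus p a S x) tags (multipliers p) covered ⟩
    good + incidences tags (multipliers p)    ≤⟨ +-monoʳ-≤ good (incidences-≤ tags (multipliers p) occurs-once) ⟩
    good + length tags                        ≡⟨ cong (good +_) length-tags ⟩
    good + 2 * length S * δ'                  ∎
    where
    open ≤-Reasoning
    good : ℕ
    good = goodCount p S x (suc δ')
    covered : ∀ {a} → a ∈ multipliers p → suc δ' ≤ ellPlus p a S x ⊎ Any (λ t → Occurs t a) tags
    covered a∈ with a>0 , a<p ← multiplier-range a∈ = AtMultiplier.good-or-tagged a>0 a<p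

-- The theorem.  A prime is nonzero; δ = δ' + 1 ≥ 1.  If δ' < p the count of
-- ShortGaps applies; otherwise p − 1 ≤ δ' ≤ 2|S|δ' already since |S| ≥ 1.
lemma6 : (p : ℕ) → Prime p → (S : List ℕ) → Unique S → All (λ y → y < p) S →
         1 ≤ length S → (x : ℕ) → x ∈ S → (δ : ℕ) → 1 ≤ δ →
         p ∸ 1 ≤ goodCount p S x δ + 2 * length S * (δ ∸ 1)
lemma6 zero    pr _ _ _ _ _ _ _ _ = contradiction refl (≢-nonZero⁻¹ 0 {{prime⇒nonZero pr}})
lemma6 (suc q) _ _ _ _ _ _ _ zero ()
lemma6 (suc q) pr S uniqS S<p |S|≥1 x x∈S (suc δ') _ with δ' <? suc q
... | yes δ'<p = ShortGaps.bound q pr S uniqS S<p x x∈S δ' δ'<p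
... | no δ'≮p  = ≤-trans (<⇒≤ (≮⇒≥ δ'≮p)) (≤-trans δ'≤2|S|δ' (m≤n+m _ _))
  where
  δ'≤2|S|δ' : δ' ≤ 2 * length S * δ'
  δ'≤2|S|δ' = m≤n*m δ' (2 * length S) {{>-nonZero (≤-trans |S|≥1 (m≤n*m (length S) 2))}}
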